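{- Let $f\in\mathbb{R}[x_1,\ldots,x_n]$ be a nonzero polynomial. There is a monomial $m$ occurring in $f$ (with nonzero coefficient) such that $\dim \partial^{=k} f \ge \dim \partial^{=k} m$ for every $k\ge 0$. In particular, if every monomial occurring in $f$ contains at least $r$ distinct variables, then $\dim \partial^{=k} f\ge \binom{r}{k}$ for every $k$.
   Context: $\partial^{=k} f$ denotes the linear space spanned by all partial derivatives $\partial_\beta f$ of order $k$, where $\beta=(\beta_1,\ldots,\beta_n)$ is a tuple of nonnegative integers with $\beta_1+\cdots+\beta_n=k$ and $\beta_i$ is the number of differentiations with respect to $x_i$. -}

module Defs where

open import Level using (Level; _⊔_) renaming (suc to lsuc)
open import Algebra.Bundles using (CommutativeRing)
open import Data.Nat as ℕ using (ℕ; zero; suc; _≤_)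
open import Data.Fin using (Fin)
open import Data.Vec as Vec using (Vec; []; _∷_; lookup; updateAt; allFin)
open import Data.Vec.Properties using (≡-dec)
open import Data.List as List using (List; []; _∷_; concat; map)
open import Data.Product using (Σ; ∃; _×_; _,_)
open import Data.Sum using (_⊎_)
open import Relation.Nullary using (¬_; yes; no)
open import Relation.Binary.PropositionalEquality using (_≡_)

-- The real numbers, axiomatised as a Dedekind-complete ordered field
-- (any model is isomorphic to ℝ).

record RealNumbers (c ℓ : Level) : Set (lsuc (c ⊔ ℓ)) where
  field
    commutativeRing : CommutativeRing c ℓ
  open CommutativeRing commutativeRing public
  field
    _<_          : Carrier → Carrier → Set ℓ
    <-irrefl     : ∀ {x y} → x ≈ y → ¬ (x < y)
    <-trans      : ∀ {x y z} → x < y → y < z → x < z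
    <-trichotomy : ∀ x y → (x < y) ⊎ (x ≈ y) ⊎ (y < x)
    <-respˡ-≈    : ∀ {x y z} → x ≈ y → x < z → y < z
    <-respʳ-≈    : ∀ {x y z} → x ≈ y → z < x → z < y
    +-mono-<     : ∀ {x y} z → x < y → (x + z) < (y + z)
    *-pos        : ∀ {x y} → 0# < x → 0# < y → 0# < (x * y)
    0<1          : 0# < 1#
    inverse      : ∀ x → ¬ (x ≈ 0#) → ∃ λ y → (x * y) ≈ 1#
    complete     : (S : Carrier → Set ℓ) → (∃ λ x → S x) →
                   (∃ λ b → ∀ x → S x → (x < b) ⊎ (x ≈ b)) →
                   ∃ λ s → (∀ x → S x → (x < s) ⊎ (x ≈ s)) ×
                           (∀ b → (∀ x → S x → (x < b) ⊎ (x ≈ b)) →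
                                  (s < b) ⊎ (s ≈ b))

Exponent : ℕ → Set
Exponent n = Vec ℕ n

numVars : ∀ {n} → Exponent n → ℕ
numVars []           = 0
numVars (zero ∷ e)   = numVars e
numVars (suc _ ∷ e)  = suc (numVars e)

module Polynomials {c ℓ} (ℝ : RealNumbers c ℓ) where
  open RealNumbers ℝ

  -- a polynomial is a finite formal sum of terms  a · x^e
  Poly : ℕ → Set c
  Poly n = List (Carrier × Exponent n)

  coeff : ∀ {n} → Poly n → Exponent n → Carrier
  coeff []              m = 0#
  coeff ((a , e) ∷ p)   m with ≡-dec ℕ._≟_ e m
  ... | yes _ = a + coeff p m
  ... | no  _ = coeff p m

  _≋_ : ∀ {n} → Poly n → Poly n → Set ℓ
  p ≋ q = ∀ m → coeff p m ≈ coeff q m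

  zeroPoly : ∀ {n} → Poly n
  zeroPoly = []

  monomial : ∀ {n} → Exponent n → Poly n
  monomial m = (1# , m) ∷ []

  Occurs : ∀ {n} → Poly n → Exponent n → Set ℓ
  Occurs f m = ¬ (coeff f m ≈ 0#)

  ℕ⇒ℝ : ℕ → Carrier
  ℕ⇒ℝ zero    = 0#
  ℕ⇒ℝ (suc k) = 1# + ℕ⇒ℝ k

  scale : ∀ {n} → Carrier → Poly n → Poly n
  scale a = map (λ { (b , e) → (a * b , e) })

  ∂ : ∀ {n} → Fin n → Poly n → Poly n
  ∂ i = map (λ { (a , e) → (a * ℕ⇒ℝ (lookup e i) , updateAt e i ℕ.pred) })

  ∂^ : ∀ {n} → Fin n → ℕ → Poly n → Poly n
  ∂^ i zero    p = p
  ∂^ i (suc j) p = ∂ i (∂^ i j p)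

  ∂[_] : ∀ {n} → Vec ℕ n → Poly n → Poly n
  ∂[_] {n} β p = Vec.foldr (λ _ → Poly n) (λ i q → ∂^ i (lookup β i) q) p (allFin n)

  MultiIndex : ℕ → ℕ → Set
  MultiIndex n k = Σ (Vec ℕ n) (λ β → Vec.sum β ≡ k)

  -- ∂^{=k} f : the linear span of all ∂_β f with |β| = k (as a predicate)
  ∂^= : ∀ {n} → ℕ → Poly n → Poly n → Set (c ⊔ ℓ)
  ∂^= {n} k f g = ∃ λ (cs : List (Carrier × MultiIndex n k)) →
                    g ≋ concat (map (λ { (a , β , _) → scale a (∂[ β ] f) }) cs)

  combo : ∀ {n d} → (Fin d → Carrier) → (Fin d → Poly n) → Poly n
  combo {d = d} cs gs = concat (Vec.toList (Vec.map (λ i → scale (cs i) (gs i)) (allFin d)))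

  LinearlyIndependent : ∀ {n d} → (Fin d → Poly n) → Set (c ⊔ ℓ)
  LinearlyIndependent {d = d} gs =
    ∀ (cs : Fin d → Carrier) → combo cs gs ≋ zeroPoly → ∀ i → cs i ≈ 0#

  DimAtLeast : ∀ {n} → (Poly n → Set (c ⊔ ℓ)) → ℕ → Set (c ⊔ ℓ)
  DimAtLeast {n} V d = ∃ λ (gs : Fin d → Poly n) → (∀ i → V (gs i)) × LinearlyIndependent gs

  -- dim V ≥ dim W (for finite-dimensional spaces)
  _DimGe_ : ∀ {n} → (Poly n → Set (c ⊔ ℓ)) → (Poly n → Set (c ⊔ ℓ)) → Set (c ⊔ ℓ)
  V DimGe W = ∀ d → DimAtLeast W d → DimAtLeast V d

module Submission where

-- Order exponents lexicographically and let x^m be the least monomial occurring in f.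
-- For β ≤ m the coefficient of ∂_β f at x^(m−β) is a nonzero multiple of the coefficient
-- of x^m in f, while for β′ lexicographically below β the coefficient of ∂_β′ f at x^(m−β)
-- is a multiple of a coefficient of f at an exponent below m, hence zero. Listed in
-- decreasing lexicographic order, the derivatives ∂_β f with β ≤ m and |β| = k therefore
-- have a triangular coefficient matrix and are linearly independent. Since ∂^{=k} x^m is
-- spanned by the monomials x^(m−β) for the same β, the linear map x^(m−β) ↦ ∂_β f embeds
-- it into ∂^{=k} f. For the binomial bound, use only the 0/1 vectors β with k ones among
-- r of the variables of m.

open import Defs
open import Level using (_⊔_)
open import Data.Empty using (⊥-elim)
open import Data.Product using (Σ; ∃; _×_; _,_; proj₁; proj₂)
open import Data.Sum using (_⊎_; inj₁; inj₂)
open import Data.Nat as ℕ using (ℕ; zero; suc; z≤n; s≤s; _≤_)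
import Data.Nat.Properties as ℕₚ
open import Data.Nat.Combinatorics using (_C_; nCk+nC[k+1]≡[n+1]C[k+1])
open import Data.Fin as Fin using (Fin)
open import Data.Vec as Vec using (Vec; []; _∷_; lookup; updateAt; allFin; tabulate)
import Data.Vec.Properties as Vecₚ
open import Data.Vec.Properties using (≡-dec)
open import Data.Vec.Relation.Binary.Pointwise.Inductive as Pointwise using (Pointwise; []; _∷_)
open import Data.Vec.Relation.Binary.Lex.Strict as Lex using (Lex-<; this; next)
open import Data.List as List using (List; []; _∷_; [_]; map; _++_; concat)
import Data.List.Properties as Listₚ
open import Data.List.Relation.Unary.All as All using (All; []; _∷_)
import Data.List.Relation.Unary.All.Properties as Allₚ
open import Data.List.Relation.Unary.Any as Any using (Any; here; there)
import Data.List.Relation.Unary.Any.Properties as Anyₚ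
open import Data.List.Relation.Unary.AllPairs as AllPairs using (AllPairs; []; _∷_)
import Data.List.Relation.Unary.AllPairs.Properties as AllPairsₚ
open import Data.List.Membership.Propositional using (_∈_; lose)
import Data.List.Membership.Propositional.Properties as ∈ₚ
open import Function using (_∘_; flip; id)
open import Relation.Nullary using (¬_; ¬?; Dec; yes; no)
open import Relation.Nullary.Decidable using (decidable-stable)
open import Relation.Unary as U using (Pred)
open import Relation.Binary.Core using (Rel)
open import Relation.Binary.Definitions using (Transitive; Decidable)
open import Relation.Binary.Structures using (IsStrictPartialOrder)
open import Relation.Binary.PropositionalEquality as ≡ using (_≡_; _≢_; refl; cong; cong₂)

AllPairs-lookup : ∀ {a ℓ} {A : Set a} {R : Rel A ℓ} {xs} → AllPairs R xs →
                  ∀ {i j} → i Fin.< j → R (List.lookup xs i) (List.lookup xs j)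
AllPairs-lookup (Rx∷xs ∷ _) {Fin.zero}  {Fin.suc j} _         = All.lookup Rx∷xs (∈ₚ.∈-lookup j)
AllPairs-lookup (_ ∷ Rxs)   {Fin.suc i} {Fin.suc j} (s≤s i<j) = AllPairs-lookup Rxs i<j

toList-map-∘ : ∀ {a b c} {A : Set a} {B : Set b} {C : Set c} {d} (f : B → C) (g : A → B) (v : Vec A d) →
               Vec.toList (Vec.map (f ∘ g) v) ≡ map f (Vec.toList (Vec.map g v))
toList-map-∘ f g v = begin
  Vec.toList (Vec.map (f ∘ g) v) ≡⟨ Vecₚ.toList-map (f ∘ g) v ⟩
  map (f ∘ g) (Vec.toList v)     ≡⟨ Listₚ.map-∘ (Vec.toList v) ⟩
  map f (map g (Vec.toList v))   ≡⟨ cong (map f) (Vecₚ.toList-map g v) ⟨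
  map f (Vec.toList (Vec.map g v)) ∎
  where open ≡.≡-Reasoning

module _ {a ℓ} {A : Set a} {_<_ : Rel A ℓ}
         (<-irrefl : ∀ {x} → ¬ x < x) (<-trans : Transitive _<_) (_<?_ : Decidable _<_) where

  minimalWitness : ∀ {p} {P : Pred A p} → U.Decidable P → ∀ xs → Any P xs →
                   ∃ λ x → P x × (∀ {y} → y ∈ xs → P y → ¬ y < x)
  minimalWitness P? (x ∷ xs) P[x∷xs] with P? x
  ... | no ¬Px with minimalWitness P? xs (Any.tail ¬Px P[x∷xs])
  ...   | w , Pw , w-min = w , Pw , λ { (here refl) Px → ⊥-elim (¬Px Px) ; (there y∈xs) → w-min y∈xs }
  minimalWitness P? (x ∷ xs) _ | yes Px with Any.any? P? xs
  ... | no ¬P[xs] = x , Px , λ { (here refl) _ → <-irrefl ; (there y∈xs) Py _ → ¬P[xs] (lose y∈xs Py) }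
  ... | yes P[xs] with minimalWitness P? xs P[xs]
  ...   | w , Pw , w-min with x <? w
  ...     | yes x<w = x , Px , λ
    { (here refl) _ → <-irrefl ; (there y∈xs) Py y<x → w-min y∈xs Py (<-trans y<x x<w) }
  ...     | no x≮w  = w , Pw , λ { (here refl) _ → x≮w ; (there y∈xs) → w-min y∈xs }

infixl 6 _⊕_ _⊖_
infix 4 _≤ᵥ_ _<ₗ_

_⊕_ _⊖_ : ∀ {n} → Vec ℕ n → Vec ℕ n → Vec ℕ n
_⊕_ = Vec.zipWith ℕ._+_
_⊖_ = Vec.zipWith ℕ._∸_

_≤ᵥ_ : ∀ {n} → Vec ℕ n → Vec ℕ n → Set
_≤ᵥ_ = Pointwise _≤_

_<ₗ_ : ∀ {n} → Vec ℕ n → Vec ℕ n → Set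
_<ₗ_ = Lex-< _≡_ ℕ._<_

<ₗ-irrefl : ∀ {n} {x : Vec ℕ n} → ¬ x <ₗ x
<ₗ-irrefl = Lex.<-irrefl ℕₚ.<-irrefl (Pointwise.refl refl)

<ₗ-trans : ∀ {n} {x y z : Vec ℕ n} → x <ₗ y → y <ₗ z → x <ₗ z
<ₗ-trans = IsStrictPartialOrder.trans (Lex.<-isStrictPartialOrder ℕₚ.<-isStrictPartialOrder)

_<ₗ?_ : ∀ {n} (x y : Vec ℕ n) → Dec (x <ₗ y)
_<ₗ?_ = Lex.<-decidable ℕ._≟_ ℕ._<?_

⊕-monoʳ-<ₗ : ∀ {n} (c : Vec ℕ n) {a b} → a <ₗ b → c ⊕ a <ₗ c ⊕ b
⊕-monoʳ-<ₗ (c ∷ _)  (this a<b eq) = this (ℕₚ.+-monoʳ-< c a<b) eq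
⊕-monoʳ-<ₗ (_ ∷ cs) (next refl p) = next refl (⊕-monoʳ-<ₗ cs p)

[m⊖β]⊕β≡m : ∀ {n} {β m : Vec ℕ n} → β ≤ᵥ m → (m ⊖ β) ⊕ β ≡ m
[m⊖β]⊕β≡m []         = refl
[m⊖β]⊕β≡m (b≤a ∷ β≤m) = cong₂ _∷_ (ℕₚ.m∸n+n≡m b≤a) ([m⊖β]⊕β≡m β≤m)

e⊕β≡m⇒e≡m⊖β : ∀ {n} (e β : Vec ℕ n) {m} → e ⊕ β ≡ m → e ≡ m ⊖ β
e⊕β≡m⇒e≡m⊖β []      []      refl = refl
e⊕β≡m⇒e≡m⊖β (x ∷ e) (b ∷ β) refl =
  cong₂ _∷_ (≡.sym (ℕₚ.m+n∸n≡m x b)) (e⊕β≡m⇒e≡m⊖β e β refl)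

e⊕β≡m⇒β≤m : ∀ {n} (e β : Vec ℕ n) {m} → e ⊕ β ≡ m → β ≤ᵥ m
e⊕β≡m⇒β≤m []      []      refl = []
e⊕β≡m⇒β≤m (x ∷ e) (b ∷ β) refl = ℕₚ.m≤n+m b x ∷ e⊕β≡m⇒β≤m e β refl

[m⊖β]⊕β′<ₗm : ∀ {n} {β β′ m : Vec ℕ n} → β ≤ᵥ m → β′ <ₗ β → (m ⊖ β) ⊕ β′ <ₗ m
[m⊖β]⊕β′<ₗm {β = β} {β′} {m} β≤m β′<β =
  ≡.subst ((m ⊖ β) ⊕ β′ <ₗ_) ([m⊖β]⊕β≡m β≤m) (⊕-monoʳ-<ₗ (m ⊖ β) β′<β)

updateAt-pred-inverse : ∀ {n} (e : Vec ℕ n) i → updateAt (updateAt e i suc) i ℕ.pred ≡ e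
updateAt-pred-inverse e i = ≡.trans (Vecₚ.updateAt-updateAt i e) (Vecₚ.updateAt-id i e)

updateAt-pred-preimage : ∀ {n} {x e : Vec ℕ n} i → updateAt x i ℕ.pred ≡ e →
                         lookup x i ≡ 0 ⊎ x ≡ updateAt e i suc
updateAt-pred-preimage {x = x} i refl with lookup x i in xᵢ
... | zero  = inj₁ refl
... | suc _ = inj₂ (≡.sym (≡.trans (Vecₚ.updateAt-updateAt i x)
                                    (Vecₚ.updateAt-id-local i x (≡.trans (cong (suc ∘ ℕ.pred) xᵢ) (≡.sym xᵢ)))))

addAt : ∀ {n t} → Vec ℕ n → Vec (Fin n) t → Vec ℕ n → Vec ℕ n
addAt β []       e = e
addAt β (i ∷ is) e = addAt β is (updateAt e i (ℕ._+ lookup β i))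

addAt-map-suc : ∀ {n t} b (β : Vec ℕ n) (is : Vec (Fin n) t) x e →
                addAt (b ∷ β) (Vec.map Fin.suc is) (x ∷ e) ≡ x ∷ addAt β is e
addAt-map-suc b β []       x e = refl
addAt-map-suc b β (i ∷ is) x e = addAt-map-suc b β is x (updateAt e i (ℕ._+ lookup β i))

addAt-allFin : ∀ {n} (β e : Vec ℕ n) → addAt β (allFin n) e ≡ e ⊕ β
addAt-allFin []      []      = refl
addAt-allFin {suc n} (b ∷ β) (x ∷ e) = begin
  addAt (b ∷ β) (tabulate Fin.suc) (x ℕ.+ b ∷ e)
    ≡⟨ cong (λ is → addAt (b ∷ β) is (x ℕ.+ b ∷ e)) (Vecₚ.tabulate-∘ Fin.suc id) ⟩
  addAt (b ∷ β) (Vec.map Fin.suc (allFin n)) (x ℕ.+ b ∷ e) ≡⟨ addAt-map-suc b β (allFin n) (x ℕ.+ b) e ⟩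
  x ℕ.+ b ∷ addAt β (allFin n) e                           ≡⟨ cong (x ℕ.+ b ∷_) (addAt-allFin β e) ⟩
  x ℕ.+ b ∷ e ⊕ β                                          ∎
  where open ≡.≡-Reasoning

Descending : ∀ {n} → List (Vec ℕ n) → Set
Descending = AllPairs (flip _<ₗ_)

map-∷-descending : ∀ {n} a {xs : List (Vec ℕ n)} → Descending xs → Descending (map (a ∷_) xs)
map-∷-descending a = AllPairsₚ.map⁺ ∘ AllPairs.map (next refl)

map-∷-++-descending : ∀ {n} a {xs : List (Vec ℕ n)} {ys} →
  Descending xs → Descending ys → All (λ y → Vec.head y ℕ.< a) ys →
  Descending (map (a ∷_) xs ++ ys)
map-∷-++-descending a {xs} ↓xs ↓ys ys<a = AllPairsₚ.++⁺ (map-∷-descending a ↓xs) ↓ys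
  (Allₚ.map⁺ (All.universal (λ _ → All.map (λ { {_ ∷ _} y<a → this y<a refl }) ys<a) xs))

prefixAtMost : ∀ {n} → ℕ → List (Vec ℕ n) → List (Vec ℕ (suc n))
prefixAtMost zero    E = map (0 ∷_) E
prefixAtMost (suc a) E = map (suc a ∷_) E ++ prefixAtMost a E

downSet : ∀ {n} → Vec ℕ n → List (Vec ℕ n)
downSet []      = [ [] ]
downSet (a ∷ m) = prefixAtMost a (downSet m)

prefixAtMost-head≤ : ∀ {n} a (E : List (Vec ℕ n)) → All (λ v → Vec.head v ≤ a) (prefixAtMost a E)
prefixAtMost-head≤ zero    E = Allₚ.map⁺ (All.universal (λ _ → z≤n) E)
prefixAtMost-head≤ (suc a) E = Allₚ.++⁺ (Allₚ.map⁺ (All.universal (λ _ → ℕₚ.≤-refl) E))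
  (All.map ℕₚ.m≤n⇒m≤1+n (prefixAtMost-head≤ a E))

prefixAtMost-descending : ∀ {n} a {E : List (Vec ℕ n)} → Descending E → Descending (prefixAtMost a E)
prefixAtMost-descending zero    ↓E = map-∷-descending 0 ↓E
prefixAtMost-descending (suc a) ↓E = map-∷-++-descending (suc a) ↓E
  (prefixAtMost-descending a ↓E) (All.map s≤s (prefixAtMost-head≤ a _))

prefixAtMost-≤ᵥ : ∀ {n} {a b m} {E : List (Vec ℕ n)} → b ≤ a → All (_≤ᵥ m) E →
                  All (_≤ᵥ a ∷ m) (prefixAtMost b E)
prefixAtMost-≤ᵥ {b = zero}  _   E≤m = Allₚ.map⁺ (All.map (z≤n ∷_) E≤m)
prefixAtMost-≤ᵥ {b = suc b} b≤a E≤m = Allₚ.++⁺ (Allₚ.map⁺ (All.map (b≤a ∷_) E≤m))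
  (prefixAtMost-≤ᵥ (ℕₚ.≤-trans (ℕₚ.n≤1+n b) b≤a) E≤m)

∈-prefixAtMost : ∀ {n} {a b} {v : Vec ℕ n} {E} → b ≤ a → v ∈ E → b ∷ v ∈ prefixAtMost a E
∈-prefixAtMost {a = zero}  z≤n v∈E = ∈ₚ.∈-map⁺ (0 ∷_) v∈E
∈-prefixAtMost {a = suc a} {b} {E = E} b≤a v∈E with b ℕ.≟ suc a
... | yes refl = ∈ₚ.∈-++⁺ˡ (∈ₚ.∈-map⁺ (suc a ∷_) v∈E)
... | no b≢a   = ∈ₚ.∈-++⁺ʳ (map (suc a ∷_) E)
                   (∈-prefixAtMost (ℕₚ.≤-pred (ℕₚ.≤∧≢⇒< b≤a b≢a)) v∈E)

downSet-descending : ∀ {n} (m : Vec ℕ n) → Descending (downSet m)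
downSet-descending []      = [] ∷ []
downSet-descending (a ∷ m) = prefixAtMost-descending a (downSet-descending m)

downSet-≤ᵥ : ∀ {n} (m : Vec ℕ n) → All (_≤ᵥ m) (downSet m)
downSet-≤ᵥ []      = [] ∷ []
downSet-≤ᵥ (a ∷ m) = prefixAtMost-≤ᵥ ℕₚ.≤-refl (downSet-≤ᵥ m)

∈-downSet : ∀ {n} {β m : Vec ℕ n} → β ≤ᵥ m → β ∈ downSet m
∈-downSet []          = here refl
∈-downSet (b≤a ∷ β≤m) = ∈-prefixAtMost b≤a (∈-downSet β≤m)

module _ {n} (k : ℕ) (m : Vec ℕ n) where
  private
    order≟k : ∀ (β : Vec ℕ n) → Dec (Vec.sum β ≡ k)
    order≟k β = Vec.sum β ℕ.≟ k

  downSetOfOrder : List (Vec ℕ n)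
  downSetOfOrder = List.filter order≟k (downSet m)

  downSetOfOrder-descending : Descending downSetOfOrder
  downSetOfOrder-descending = AllPairsₚ.filter⁺ order≟k (downSet-descending m)

  downSetOfOrder-≤ᵥ : All (_≤ᵥ m) downSetOfOrder
  downSetOfOrder-≤ᵥ = Allₚ.filter⁺ order≟k (downSet-≤ᵥ m)

  downSetOfOrder-order : All (λ β → Vec.sum β ≡ k) downSetOfOrder
  downSetOfOrder-order = Allₚ.all-filter order≟k (downSet m)

  ∈-downSetOfOrder : ∀ {β} → β ≤ᵥ m → Vec.sum β ≡ k → β ∈ downSetOfOrder
  ∈-downSetOfOrder β≤m |β|≡k = ∈ₚ.∈-filter⁺ order≟k (∈-downSet β≤m) |β|≡k

-- The 0/1 exponents with exactly k ones, all placed among the first r variables occurring in m.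
choose : ∀ {n} → ℕ → Vec ℕ n → ℕ → List (Vec ℕ n)
choose r       []          zero    = [ [] ]
choose r       []          (suc k) = []
choose r       (zero ∷ m)  k       = map (0 ∷_) (choose r m k)
choose zero    (suc _ ∷ m) k       = map (0 ∷_) (choose zero m k)
choose (suc r) (suc _ ∷ m) zero    = map (0 ∷_) (choose r m zero)
choose (suc r) (suc _ ∷ m) (suc k) = map (1 ∷_) (choose r m k) ++ map (0 ∷_) (choose r m (suc k))

length-choose : ∀ {n} r (m : Vec ℕ n) k → r ≤ numVars m → List.length (choose r m k) ≡ r C k
length-choose _       []          zero    z≤n = refl
length-choose _       []          (suc k) z≤n = refl
length-choose r       (zero ∷ m)  k       r≤ =
  ≡.trans (Listₚ.length-map _ (choose r m k)) (length-choose r m k r≤)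
length-choose zero    (suc _ ∷ m) k       _ =
  ≡.trans (Listₚ.length-map _ (choose zero m k)) (length-choose zero m k z≤n)
length-choose (suc r) (suc _ ∷ m) zero    (s≤s r≤) =
  ≡.trans (Listₚ.length-map _ (choose r m zero)) (length-choose r m zero r≤)
length-choose (suc r) (suc _ ∷ m) (suc k) (s≤s r≤) = begin
  List.length (map (1 ∷_) (choose r m k) ++ map (0 ∷_) (choose r m (suc k)))
    ≡⟨ Listₚ.length-++ (map (1 ∷_) (choose r m k)) ⟩
  List.length (map (1 ∷_) (choose r m k)) ℕ.+ List.length (map (0 ∷_) (choose r m (suc k)))
    ≡⟨ cong₂ ℕ._+_ (Listₚ.length-map _ (choose r m k)) (Listₚ.length-map _ (choose r m (suc k))) ⟩
  List.length (choose r m k) ℕ.+ List.length (choose r m (suc k))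
    ≡⟨ cong₂ ℕ._+_ (length-choose r m k r≤) (length-choose r m (suc k) r≤) ⟩
  r C k ℕ.+ r C suc k
    ≡⟨ nCk+nC[k+1]≡[n+1]C[k+1] r k ⟩
  suc r C suc k ∎
  where open ≡.≡-Reasoning

choose-descending : ∀ {n} r (m : Vec ℕ n) k → Descending (choose r m k)
choose-descending _       []          zero    = [] ∷ []
choose-descending _       []          (suc k) = []
choose-descending r       (zero ∷ m)  k       = map-∷-descending 0 (choose-descending r m k)
choose-descending zero    (suc _ ∷ m) k       = map-∷-descending 0 (choose-descending zero m k)
choose-descending (suc r) (suc _ ∷ m) zero    = map-∷-descending 0 (choose-descending r m zero)
choose-descending (suc r) (suc _ ∷ m) (suc k) = map-∷-++-descending 1 (choose-descending r m k)
  (map-∷-descending 0 (choose-descending r m (suc k)))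
  (Allₚ.map⁺ (All.universal (λ _ → s≤s z≤n) (choose r m (suc k))))

choose-≤ᵥ : ∀ {n} r (m : Vec ℕ n) k → All (_≤ᵥ m) (choose r m k)
choose-≤ᵥ _       []          zero    = [] ∷ []
choose-≤ᵥ _       []          (suc k) = []
choose-≤ᵥ r       (zero ∷ m)  k       = Allₚ.map⁺ (All.map (z≤n ∷_) (choose-≤ᵥ r m k))
choose-≤ᵥ zero    (suc _ ∷ m) k       = Allₚ.map⁺ (All.map (z≤n ∷_) (choose-≤ᵥ zero m k))
choose-≤ᵥ (suc r) (suc _ ∷ m) zero    = Allₚ.map⁺ (All.map (z≤n ∷_) (choose-≤ᵥ r m zero))
choose-≤ᵥ (suc r) (suc _ ∷ m) (suc k) = Allₚ.++⁺
  (Allₚ.map⁺ (All.map (s≤s z≤n ∷_) (choose-≤ᵥ r m k)))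
  (Allₚ.map⁺ (All.map (z≤n ∷_) (choose-≤ᵥ r m (suc k))))

choose-order : ∀ {n} r (m : Vec ℕ n) k → All (λ β → Vec.sum β ≡ k) (choose r m k)
choose-order _       []          zero    = refl ∷ []
choose-order _       []          (suc k) = []
choose-order r       (zero ∷ m)  k       = Allₚ.map⁺ (choose-order r m k)
choose-order zero    (suc _ ∷ m) k       = Allₚ.map⁺ (choose-order zero m k)
choose-order (suc r) (suc _ ∷ m) zero    = Allₚ.map⁺ (choose-order r m zero)
choose-order (suc r) (suc _ ∷ m) (suc k) = Allₚ.++⁺
  (Allₚ.map⁺ (All.map (cong suc) (choose-order r m k)))
  (Allₚ.map⁺ (choose-order r m (suc k)))

module _ {c ℓ} (ℝ : RealNumbers c ℓ) where
  open RealNumbers ℝ renaming (refl to ≈-refl; sym to ≈-sym; trans to ≈-trans)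
  open Polynomials ℝ
  open import Relation.Binary.Reasoning.Setoid setoid
  open import Algebra.Properties.Semiring.Sum semiring
    using (sum-syntax; sum-cong-≋; sum-replicate-zero; ∑-comm; *-distribˡ-sum; *-distribʳ-sum)

  1+ℕ⇒ℝ-pos : ∀ k → 0# < ℕ⇒ℝ (suc k)
  1+ℕ⇒ℝ-pos zero    = <-respʳ-≈ (≈-sym (+-identityʳ 1#)) 0<1
  1+ℕ⇒ℝ-pos (suc k) = <-trans (1+ℕ⇒ℝ-pos k) (<-respˡ-≈ (+-identityˡ _) (+-mono-< (ℕ⇒ℝ (suc k)) 0<1))

  pos⇒≉0 : ∀ {x} → 0# < x → ¬ x ≈ 0#
  pos⇒≉0 0<x x≈0 = <-irrefl (≈-sym x≈0) 0<x

  _≈0? : ∀ x → Dec (x ≈ 0#)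
  x ≈0? with <-trichotomy x 0#
  ... | inj₁ x<0         = no λ x≈0 → <-irrefl x≈0 x<0
  ... | inj₂ (inj₁ x≈0)  = yes x≈0
  ... | inj₂ (inj₂ 0<x)  = no (pos⇒≉0 0<x)

  *-cancelʳ-≈0 : ∀ {a b} → ¬ b ≈ 0# → a * b ≈ 0# → a ≈ 0#
  *-cancelʳ-≈0 {a} {b} b≉0 ab≈0 with inverse b b≉0
  ... | b⁻¹ , bb⁻¹≈1 = begin
    a              ≈⟨ *-identityʳ a ⟨
    a * 1#         ≈⟨ *-congˡ bb⁻¹≈1 ⟨
    a * (b * b⁻¹)  ≈⟨ *-assoc a b b⁻¹ ⟨
    a * b * b⁻¹    ≈⟨ *-congʳ ab≈0 ⟩
    0# * b⁻¹       ≈⟨ zeroˡ b⁻¹ ⟩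
    0#             ∎

  *-≉0 : ∀ {a b} → ¬ a ≈ 0# → ¬ b ≈ 0# → ¬ a * b ≈ 0#
  *-≉0 a≉0 b≉0 = a≉0 ∘ *-cancelʳ-≈0 b≉0

  ∑-≈0 : ∀ {d} {f : Fin d → Carrier} → (∀ i → f i ≈ 0#) → ∑[ i < d ] f i ≈ 0#
  ∑-≈0 {d} f≈0 = ≈-trans (sum-cong-≋ f≈0) (sum-replicate-zero d)

  module _ {n : ℕ} where

    coeff-++ : ∀ (p q : Poly n) e → coeff (p ++ q) e ≈ coeff p e + coeff q e
    coeff-++ []            q e = ≈-sym (+-identityˡ _)
    coeff-++ ((a , x) ∷ p) q e with ≡-dec ℕ._≟_ x e
    ... | yes _ = ≈-trans (+-congˡ (coeff-++ p q e)) (≈-sym (+-assoc _ _ _))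
    ... | no  _ = coeff-++ p q e

    coeff-scale : ∀ a (p : Poly n) e → coeff (scale a p) e ≈ a * coeff p e
    coeff-scale a []            e = ≈-sym (zeroʳ a)
    coeff-scale a ((b , x) ∷ p) e with ≡-dec ℕ._≟_ x e
    ... | yes _ = ≈-trans (+-congˡ (coeff-scale a p e)) (≈-sym (distribˡ a b _))
    ... | no  _ = coeff-scale a p e

    coeff-concat-map-≈0 : ∀ {a} {A : Set a} (h : A → Poly n) xs e →
                          (∀ x → coeff (h x) e ≈ 0#) → coeff (concat (map h xs)) e ≈ 0#
    coeff-concat-map-≈0 h []       e _     = ≈-refl
    coeff-concat-map-≈0 h (x ∷ xs) e hₓ≈0 = begin
      coeff (h x ++ concat (map h xs)) e          ≈⟨ coeff-++ (h x) _ e ⟩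
      coeff (h x) e + coeff (concat (map h xs)) e ≈⟨ +-cong (hₓ≈0 x) (coeff-concat-map-≈0 h xs e hₓ≈0) ⟩
      0# + 0#                                     ≈⟨ +-identityˡ 0# ⟩
      0#                                          ∎

    combo-suc : ∀ {d} (cs : Fin (suc d) → Carrier) (gs : Fin (suc d) → Poly n) →
                combo cs gs ≡ scale (cs Fin.zero) (gs Fin.zero) ++ combo (cs ∘ Fin.suc) (gs ∘ Fin.suc)
    combo-suc cs gs = cong (λ v → scale (cs Fin.zero) (gs Fin.zero) ++ concat (Vec.toList v))
      (≡.trans (≡.sym (Vecₚ.tabulate-∘ term Fin.suc)) (Vecₚ.tabulate-∘ (term ∘ Fin.suc) id))
      where term = λ i → scale (cs i) (gs i)

    coeff-combo : ∀ {d} (cs : Fin d → Carrier) (gs : Fin d → Poly n) e →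
                  coeff (combo cs gs) e ≈ ∑[ i < d ] (cs i * coeff (gs i) e)
    coeff-combo {zero}  cs gs e = ≈-refl
    coeff-combo {suc d} cs gs e rewrite combo-suc cs gs = begin
      coeff (scale (cs Fin.zero) (gs Fin.zero) ++ combo (cs ∘ Fin.suc) (gs ∘ Fin.suc)) e
        ≈⟨ coeff-++ (scale (cs Fin.zero) (gs Fin.zero)) _ e ⟩
      coeff (scale (cs Fin.zero) (gs Fin.zero)) e + coeff (combo (cs ∘ Fin.suc) (gs ∘ Fin.suc)) e
        ≈⟨ +-cong (coeff-scale (cs Fin.zero) (gs Fin.zero) e) (coeff-combo (cs ∘ Fin.suc) (gs ∘ Fin.suc) e) ⟩
      ∑[ i < suc d ] (cs i * coeff (gs i) e) ∎

    combo-combo : ∀ {d N} (λs : Fin d → Carrier) (D : Fin d → Fin N → Carrier) (hs : Fin N → Poly n) →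
                  combo λs (λ i → combo (D i) hs) ≋ combo (λ j → ∑[ i < d ] (λs i * D i j)) hs
    combo-combo {d} {N} λs D hs e = begin
      coeff (combo λs (λ i → combo (D i) hs)) e
        ≈⟨ coeff-combo λs _ e ⟩
      ∑[ i < d ] (λs i * coeff (combo (D i) hs) e)
        ≈⟨ sum-cong-≋ (λ i → *-congˡ (coeff-combo (D i) hs e)) ⟩
      ∑[ i < d ] (λs i * ∑[ j < N ] (D i j * h j))
        ≈⟨ sum-cong-≋ (λ i → *-distribˡ-sum (λs i) (λ j → D i j * h j)) ⟩
      ∑[ i < d ] ∑[ j < N ] (λs i * (D i j * h j))
        ≈⟨ ∑-comm (λ i j → λs i * (D i j * h j)) ⟩
      ∑[ j < N ] ∑[ i < d ] (λs i * (D i j * h j))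
        ≈⟨ sum-cong-≋ (λ j → sum-cong-≋ (λ i → *-assoc (λs i) (D i j) (h j))) ⟨
      ∑[ j < N ] ∑[ i < d ] (λs i * D i j * h j)
        ≈⟨ sum-cong-≋ (λ j → *-distribʳ-sum (h j) (λ i → λs i * D i j)) ⟨
      ∑[ j < N ] (∑[ i < d ] (λs i * D i j) * h j)
        ≈⟨ coeff-combo _ hs e ⟨
      coeff (combo (λ j → ∑[ i < d ] (λs i * D i j)) hs) e ∎
      where
      h : Fin N → Carrier
      h j = coeff (hs j) e

    record Rescales (D : Poly n → Poly n) (e e′ : Exponent n) : Set (c ⊔ ℓ) where
      constructor rescaling
      field
        factor   : Carrier
        factor≉0 : ¬ factor ≈ 0#
        coeff≈   : ∀ p → coeff (D p) e ≈ factor * coeff p e′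

    rescales-id : ∀ e → Rescales id e e
    rescales-id e = rescaling 1# (pos⇒≉0 0<1) λ p → ≈-sym (*-identityˡ _)

    rescales-∘ : ∀ {D D′ e e′ e″} → Rescales D e e′ → Rescales D′ e′ e″ → Rescales (D ∘ D′) e e″
    rescales-∘ {D} {D′} {e} {e′} {e″} (rescaling K K≉0 DK) (rescaling K′ K′≉0 D′K′) =
      rescaling (K * K′) (*-≉0 K≉0 K′≉0) λ p → begin
        coeff (D (D′ p)) e     ≈⟨ DK (D′ p) ⟩
        K * coeff (D′ p) e′    ≈⟨ *-congˡ (D′K′ p) ⟩
        K * (K′ * coeff p e″)  ≈⟨ *-assoc K K′ _ ⟨
        K * K′ * coeff p e″    ∎

    rescales-≡ : ∀ {D e e′ e″} → e′ ≡ e″ → Rescales D e e′ → Rescales D e e″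
    rescales-≡ refl = id

    -- A term without x_i is also sent to e (ℕ.pred 0 = 0), but with weight ℕ⇒ℝ 0 = 0#.
    rescales-∂ : ∀ i e → Rescales (∂ i) e (updateAt e i suc)
    rescales-∂ i e = rescaling (ℕ⇒ℝ (suc (lookup e i))) (pos⇒≉0 (1+ℕ⇒ℝ-pos (lookup e i))) coeff-∂
      where
      e⁺ : Exponent n
      e⁺ = updateAt e i suc
      N : Carrier
      N = ℕ⇒ℝ (suc (lookup e i))
      coeff-∂ : ∀ p → coeff (∂ i p) e ≈ N * coeff p e⁺
      coeff-∂ []            = ≈-sym (zeroʳ N)
      coeff-∂ ((a , x) ∷ p) with ≡-dec ℕ._≟_ (updateAt x i ℕ.pred) e | ≡-dec ℕ._≟_ x e⁺
      ... | no x⁻≢e  | yes refl = ⊥-elim (x⁻≢e (updateAt-pred-inverse e i))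
      ... | no _     | no _     = coeff-∂ p
      ... | yes x⁻≡e | yes refl = begin
        a * ℕ⇒ℝ (lookup e⁺ i) + coeff (∂ i p) e
          ≈⟨ +-cong (*-congˡ (reflexive (cong ℕ⇒ℝ (Vecₚ.lookup∘updateAt i e)))) (coeff-∂ p) ⟩
        a * N + N * coeff p e⁺                  ≈⟨ +-congʳ (*-comm a N) ⟩
        N * a + N * coeff p e⁺                  ≈⟨ distribˡ N a _ ⟨
        N * (a + coeff p e⁺)                    ∎
      ... | yes x⁻≡e | no x≢e⁺ with updateAt-pred-preimage i x⁻≡e
      ...   | inj₂ x≡e⁺ = ⊥-elim (x≢e⁺ x≡e⁺)
      ...   | inj₁ xᵢ≡0 = begin
        a * ℕ⇒ℝ (lookup x i) + coeff (∂ i p) e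
          ≈⟨ +-cong (*-congˡ (reflexive (cong ℕ⇒ℝ xᵢ≡0))) (coeff-∂ p) ⟩
        a * 0# + N * coeff p e⁺                ≈⟨ +-congʳ (zeroʳ a) ⟩
        0# + N * coeff p e⁺                    ≈⟨ +-identityˡ _ ⟩
        N * coeff p e⁺                         ∎

    rescales-∂^ : ∀ i j e → Rescales (∂^ i j) e (updateAt e i (ℕ._+ j))
    rescales-∂^ i zero    e = rescales-≡ (≡.sym (Vecₚ.updateAt-id-local i e (ℕₚ.+-identityʳ _))) (rescales-id e)
    rescales-∂^ i (suc j) e = rescales-≡ (Vecₚ.updateAt-updateAt-local i e (≡.sym (ℕₚ.+-suc _ j)))
      (rescales-∘ (rescales-∂ i e) (rescales-∂^ i j (updateAt e i suc)))

    -- ∂[ β ] p is definitionally ∂along β (allFin n) p.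
    ∂along : ∀ {t} → Vec ℕ n → Vec (Fin n) t → Poly n → Poly n
    ∂along β is p = Vec.foldr (λ _ → Poly n) (λ i q → ∂^ i (lookup β i) q) p is

    rescales-∂along : ∀ {t} β (is : Vec (Fin n) t) e → Rescales (∂along β is) e (addAt β is e)
    rescales-∂along β []       e = rescales-id e
    rescales-∂along β (i ∷ is) e =
      rescales-∘ (rescales-∂^ i (lookup β i) e) (rescales-∂along β is (updateAt e i (ℕ._+ lookup β i)))

    rescales-∂[] : ∀ β e → Rescales ∂[ β ] e (e ⊕ β)
    rescales-∂[] β e = rescales-≡ (addAt-allFin β e) (rescales-∂along β (allFin n) e)

    triangular⇒independent : ∀ {d} (gs : Fin d → Poly n) (pts : Fin d → Exponent n) →
      (∀ i → ¬ coeff (gs i) (pts i) ≈ 0#) →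
      (∀ {i j} → i Fin.< j → coeff (gs j) (pts i) ≈ 0#) →
      LinearlyIndependent gs
    triangular⇒independent {suc d} gs pts diag≉0 upper≈0 cs combo≋0 = cs≈0
      where
      c₀ : Carrier
      c₀ = cs Fin.zero
      tail : Exponent n → Carrier
      tail e = ∑[ j < d ] (cs (Fin.suc j) * coeff (gs (Fin.suc j)) e)

      c₀g₀+tail≈0 : ∀ e → c₀ * coeff (gs Fin.zero) e + tail e ≈ 0#
      c₀g₀+tail≈0 e = ≈-trans (≈-sym (coeff-combo cs gs e)) (combo≋0 e)

      tail[pts₀]≈0 : tail (pts Fin.zero) ≈ 0#
      tail[pts₀]≈0 = ∑-≈0 λ j →
        ≈-trans (*-congˡ (upper≈0 {j = Fin.suc j} (s≤s z≤n))) (zeroʳ (cs (Fin.suc j)))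

      c₀≈0 : c₀ ≈ 0#
      c₀≈0 = *-cancelʳ-≈0 (diag≉0 Fin.zero) (begin
        c₀ * coeff (gs Fin.zero) (pts Fin.zero)                             ≈⟨ +-identityʳ _ ⟨
        c₀ * coeff (gs Fin.zero) (pts Fin.zero) + 0#                        ≈⟨ +-congˡ tail[pts₀]≈0 ⟨
        c₀ * coeff (gs Fin.zero) (pts Fin.zero) + tail (pts Fin.zero)       ≈⟨ c₀g₀+tail≈0 (pts Fin.zero) ⟩
        0#                                                                  ∎)

      tail≋0 : combo (cs ∘ Fin.suc) (gs ∘ Fin.suc) ≋ zeroPoly
      tail≋0 e = begin
        coeff (combo (cs ∘ Fin.suc) (gs ∘ Fin.suc)) e  ≈⟨ coeff-combo (cs ∘ Fin.suc) (gs ∘ Fin.suc) e ⟩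
        tail e                                         ≈⟨ +-identityˡ _ ⟨
        0# + tail e                                    ≈⟨ +-congʳ (≈-trans (*-congʳ c₀≈0) (zeroˡ _)) ⟨
        c₀ * coeff (gs Fin.zero) e + tail e            ≈⟨ c₀g₀+tail≈0 e ⟩
        0#                                             ∎

      cs≈0 : ∀ i → cs i ≈ 0#
      cs≈0 Fin.zero    = c₀≈0
      cs≈0 (Fin.suc i) = triangular⇒independent (gs ∘ Fin.suc) (pts ∘ Fin.suc) (diag≉0 ∘ Fin.suc)
                           (upper≈0 ∘ s≤s) (cs ∘ Fin.suc) tail≋0 i

    coeff≉0⇒∈exponents : ∀ (p : Poly n) {e} → ¬ coeff p e ≈ 0# → e ∈ map proj₂ p
    coeff≉0⇒∈exponents []            c≉0 = ⊥-elim (c≉0 ≈-refl)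
    coeff≉0⇒∈exponents ((a , x) ∷ p) {e} c≉0 with ≡-dec ℕ._≟_ x e
    ... | yes refl = here refl
    ... | no  _    = there (coeff≉0⇒∈exponents p c≉0)

    leastExponent : ∀ f → ¬ f ≋ zeroPoly → ∃ λ m → Occurs f m × (∀ {e} → e <ₗ m → coeff f e ≈ 0#)
    leastExponent f f≉0 with minimalWitness <ₗ-irrefl <ₗ-trans _<ₗ?_ occurs? (map proj₂ f) someOccurs
      where
      occurs? : ∀ e → Dec (Occurs f e)
      occurs? e = ¬? (coeff f e ≈0?)
      someOccurs : Any (Occurs f) (map proj₂ f)
      someOccurs with Any.any? occurs? (map proj₂ f)
      ... | yes occ = occ
      ... | no  ¬occ = ⊥-elim (f≉0 λ e →
        decidable-stable (coeff f e ≈0?) λ c≉0 → ¬occ (lose (coeff≉0⇒∈exponents f c≉0) c≉0))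
    ... | m , m-occurs , m-minimal = m , m-occurs , λ {e} e<m →
      decidable-stable (coeff f e ≈0?) λ c≉0 → m-minimal (coeff≉0⇒∈exponents f c≉0) c≉0 e<m

    coeff-monomial-≢ : ∀ {m x : Exponent n} → m ≢ x → coeff (monomial m) x ≈ 0#
    coeff-monomial-≢ {m} {x} m≢x with ≡-dec ℕ._≟_ m x
    ... | yes m≡x = ⊥-elim (m≢x m≡x)
    ... | no  _   = ≈-refl

    ∂^=-monomial-vanishes : ∀ {k m} g e → ∂^= k (monomial m) g →
                            ¬ Any (λ β → e ≡ m ⊖ β) (downSetOfOrder k m) → coeff g e ≈ 0#
    ∂^=-monomial-vanishes {k} {m} g e (cs , g≋) e∉ =
      ≈-trans (g≋ e) (coeff-concat-map-≈0 _ cs e λ { (a , β , |β|≡k) → term≈0 a β |β|≡k })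
      where
      term≈0 : ∀ a β → Vec.sum β ≡ k → coeff (scale a (∂[ β ] (monomial m))) e ≈ 0#
      term≈0 a β |β|≡k with rescales-∂[] β e | ≡-dec ℕ._≟_ m (e ⊕ β)
      ... | _ | yes m≡e⊕β = ⊥-elim (e∉ (lose
              (∈-downSetOfOrder k m (e⊕β≡m⇒β≤m e β (≡.sym m≡e⊕β)) |β|≡k)
              (e⊕β≡m⇒e≡m⊖β e β (≡.sym m≡e⊕β))))
      ... | rescaling K _ coeff≈ | no m≢e⊕β = begin
        coeff (scale a (∂[ β ] (monomial m))) e    ≈⟨ coeff-scale a (∂[ β ] (monomial m)) e ⟩
        a * coeff (∂[ β ] (monomial m)) e          ≈⟨ *-congˡ (coeff≈ (monomial m)) ⟩
        a * (K * coeff (monomial m) (e ⊕ β))       ≈⟨ *-congˡ (*-congˡ (coeff-monomial-≢ m≢e⊕β)) ⟩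
        a * (K * 0#)                               ≈⟨ *-congˡ (zeroʳ K) ⟩
        a * 0#                                     ≈⟨ zeroʳ a ⟩
        0#                                         ∎

    ∂[]-∈-∂^= : ∀ {k} f (β : MultiIndex n k) → ∂^= k f (∂[ proj₁ β ] f)
    ∂[]-∈-∂^= f β = [ (1# , β) ] , λ e → ≈-sym (begin
      coeff (scale 1# (∂[ proj₁ β ] f) ++ []) e  ≈⟨ coeff-++ (scale 1# (∂[ proj₁ β ] f)) [] e ⟩
      coeff (scale 1# (∂[ proj₁ β ] f)) e + 0#   ≈⟨ +-identityʳ _ ⟩
      coeff (scale 1# (∂[ proj₁ β ] f)) e        ≈⟨ coeff-scale 1# (∂[ proj₁ β ] f) e ⟩
      1# * coeff (∂[ proj₁ β ] f) e              ≈⟨ *-identityˡ _ ⟩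
      coeff (∂[ proj₁ β ] f) e                   ∎)

    combo-∈-∂^= : ∀ {k d} f (cs : Fin d → Carrier) (βs : Fin d → MultiIndex n k) →
                  ∂^= k f (combo cs (λ j → ∂[ proj₁ (βs j) ] f))
    combo-∈-∂^= {d = d} f cs βs = Vec.toList (Vec.map (λ j → cs j , βs j) (allFin d)) ,
      λ e → reflexive (cong (λ q → coeff q e) (cong concat (toList-map-∘ _ (λ j → cs j , βs j) (allFin d))))

    module _ {f : Poly n} {m : Exponent n}
             (m-occurs : Occurs f m) (m-least : ∀ {e} → e <ₗ m → coeff f e ≈ 0#) where

      ∂[]-independent : (B : List (Exponent n)) → Descending B → All (_≤ᵥ m) B →
                        LinearlyIndependent (λ j → ∂[ List.lookup B j ] f)
      ∂[]-independent B ↓B B≤m = triangular⇒independent _ (λ j → m ⊖ β j) diag≉0 upper≈0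
        where
        β : Fin (List.length B) → Exponent n
        β = List.lookup B

        β≤m : ∀ j → β j ≤ᵥ m
        β≤m j = All.lookup B≤m (∈ₚ.∈-lookup j)

        diag≉0 : ∀ j → ¬ coeff (∂[ β j ] f) (m ⊖ β j) ≈ 0#
        diag≉0 j with rescales-∂[] (β j) (m ⊖ β j)
        ... | rescaling K K≉0 coeff≈ rewrite [m⊖β]⊕β≡m (β≤m j) =
          *-≉0 K≉0 m-occurs ∘ ≈-trans (≈-sym (coeff≈ f))

        upper≈0 : ∀ {i j} → i Fin.< j → coeff (∂[ β j ] f) (m ⊖ β i) ≈ 0#
        upper≈0 {i} {j} i<j with rescales-∂[] (β j) (m ⊖ β i)
        ... | rescaling K _ coeff≈ = begin
          coeff (∂[ β j ] f) (m ⊖ β i)    ≈⟨ coeff≈ f ⟩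
          K * coeff f (m ⊖ β i ⊕ β j)
            ≈⟨ *-congˡ (m-least ([m⊖β]⊕β′<ₗm (β≤m i) (AllPairs-lookup ↓B i<j))) ⟩
          K * 0#                          ≈⟨ zeroʳ K ⟩
          0#                              ∎

      ∂^=-dimGe-monomial : ∀ k → ∂^= k f DimGe ∂^= k (monomial m)
      ∂^=-dimGe-monomial k d (gs , gs∈ , gs-independent) = gs′ , gs′∈ , gs′-independent
        where
        B : List (Exponent n)
        B = downSetOfOrder k m
        N : ℕ
        N = List.length B

        β : Fin N → MultiIndex n k
        β j = List.lookup B j , All.lookup (downSetOfOrder-order k m) (∈ₚ.∈-lookup j)

        ∂β : Fin N → Poly n
        ∂β j = ∂[ proj₁ (β j) ] f

        D : Fin d → Fin N → Carrier
        D i j = coeff (gs i) (m ⊖ proj₁ (β j))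

        -- gs′ i is the image of gs i under x^(m−β) ↦ ∂_β f.
        gs′ : Fin d → Poly n
        gs′ i = combo (D i) ∂β

        gs′∈ : ∀ i → ∂^= k f (gs′ i)
        gs′∈ i = combo-∈-∂^= f (D i) β

        gs′-independent : LinearlyIndependent gs′
        gs′-independent λs Σλgs′≋0 = gs-independent λs Σλgs≋0
          where
          Σλgs[m⊖β]≈0 : ∀ j → ∑[ i < d ] (λs i * D i j) ≈ 0#
          Σλgs[m⊖β]≈0 = ∂[]-independent B (downSetOfOrder-descending k m) (downSetOfOrder-≤ᵥ k m) _
            λ e → ≈-trans (≈-sym (combo-combo λs D ∂β e)) (Σλgs′≋0 e)

          Σλgs≋0 : combo λs gs ≋ zeroPoly
          Σλgs≋0 e with Any.any? (λ β → ≡-dec ℕ._≟_ e (m ⊖ β)) B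
          ... | yes e∈m⊖B rewrite Anyₚ.lookup-index e∈m⊖B =
            ≈-trans (coeff-combo λs gs _) (Σλgs[m⊖β]≈0 (Any.index e∈m⊖B))
          ... | no  e∉m⊖B = ≈-trans (coeff-combo λs gs e)
            (∑-≈0 λ i → ≈-trans (*-congˡ (∂^=-monomial-vanishes (gs i) e (gs∈ i) e∉m⊖B)) (zeroʳ (λs i)))

      ∂^=-dimAtLeast : ∀ k (B : List (Exponent n)) → Descending B → All (_≤ᵥ m) B →
                       All (λ β → Vec.sum β ≡ k) B → DimAtLeast (∂^= k f) (List.length B)
      ∂^=-dimAtLeast k B ↓B B≤m B-order =
        (λ j → ∂[ List.lookup B j ] f) ,
        (λ j → ∂[]-∈-∂^= f (List.lookup B j , All.lookup B-order (∈ₚ.∈-lookup j))) ,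
        ∂[]-independent B ↓B B≤m

theorem1 : ∀ {c ℓ} (ℝ : RealNumbers c ℓ) (n : ℕ) →
    let open Polynomials ℝ in
    (f : Poly n) → ¬ (f ≋ zeroPoly) →
      (Σ (Exponent n) λ m → Occurs f m × (∀ k → ∂^= k f DimGe ∂^= k (monomial m)))
      × (∀ r → (∀ e → Occurs f e → r ≤ numVars e) → ∀ k → DimAtLeast (∂^= k f) (r C k))
theorem1 ℝ n f f≉0 with leastExponent ℝ f f≉0
... | m , m-occurs , m-least = (m , m-occurs , ∂^=-dimGe-monomial ℝ m-occurs m-least) , λ r r≤vars k →
  ≡.subst (DimAtLeast (∂^= k f)) (length-choose r m k (r≤vars m m-occurs))
    (∂^=-dimAtLeast ℝ m-occurs m-least k (choose r m k)
      (choose-descending r m k) (choose-≤ᵥ r m k) (choose-order r m k))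
  where open Polynomials ℝ
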